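{- Let $d$ be a constant. For every graph $G=(V,E)$ of maximum degree at most $d$ and every $c\in\{0,1\}^V$ with $\bigoplus_{v\in V}c_v=1$, the Tseitin formula $T_{G,c}$ has an Odd Hitting refutation of size polynomial in $|V|$.
   Context: $T_{G,c}$ has a variable $x_e$ for every $e\in E$ and, for every vertex $v$, encodes the constraint $\bigoplus_{e\ni v}x_e=c_v$ as the $2^{\deg v-1}$ clauses of width $\deg v$ over the variables $\{x_e: e\ni v\}$ that exclude exactly the assignments violating it. An odd hitting formula is a CNF $H$ such that every assignment falsifying $H$ falsifies an odd number of clauses of $H$. An Odd Hitting refutation of a CNF $F$ is an unsatisfiable odd hitting formula $H$ such that every clause $C$ of $H$ has a clause $C'\subseteq C$ belonging to $F$; size = number of clauses. -}

module Defs where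

open import Data.Nat using (ℕ; zero; suc; _+_; _*_; _^_; _≤_; _%_)
open import Data.Bool using (Bool; true; false; not; _xor_; _∧_; if_then_else_)
open import Data.Fin using (Fin; toℕ)
open import Data.Nat using (_<ᵇ_)
open import Data.Product using (_×_; _,_; Σ; ∃; proj₁; proj₂)
open import Data.List using (List; []; _∷_; length; map; concatMap; allFin; filterᵇ; foldr; _++_)
open import Data.List.Membership.Propositional using (_∈_)
open import Data.List.Relation.Binary.Subset.Propositional using (_⊆_)
open import Relation.Binary.PropositionalEquality using (_≡_; _≢_)

-- a literal: a variable together with the polarity under which it is true
Lit : Set → Set
Lit X = X × Bool

Clause : Set → Set
Clause X = List (Lit X)

CNF : Set → Set
CNF X = List (Clause X)

Assignment : Set → Set
Assignment X = X → Bool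

litVal : {X : Set} → Assignment X → Lit X → Bool
litVal α (x , true)  = α x
litVal α (x , false) = not (α x)

falsifiesᵇ : {X : Set} → Assignment X → Clause X → Bool
falsifiesᵇ α []      = true
falsifiesᵇ α (l ∷ C) = not (litVal α l) ∧ falsifiesᵇ α C

falsifiesCNFᵇ : {X : Set} → Assignment X → CNF X → Bool
falsifiesCNFᵇ α []      = false
falsifiesCNFᵇ α (C ∷ H) = if falsifiesᵇ α C then true else falsifiesCNFᵇ α H

numFalsified : {X : Set} → Assignment X → CNF X → ℕ
numFalsified α H = length (filterᵇ (falsifiesᵇ α) H)

Unsatisfiable : {X : Set} → CNF X → Set
Unsatisfiable {X} H = (α : Assignment X) → falsifiesCNFᵇ α H ≡ true

OddHitting : {X : Set} → CNF X → Set
OddHitting {X} H =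
  (α : Assignment X) → falsifiesCNFᵇ α H ≡ true → numFalsified α H % 2 ≡ 1

IsOHRefutation : {X : Set} → CNF X → CNF X → Set
IsOHRefutation F H =
  Unsatisfiable H × OddHitting H ×
  (∀ {C} → C ∈ H → ∃ λ C' → C' ∈ F × C' ⊆ C)

record Graph (n : ℕ) : Set where
  field
    adj     : Fin n → Fin n → Bool
    sym     : ∀ u v → adj u v ≡ adj v u
    irrefl  : ∀ v → adj v v ≡ false
open Graph public

neighbours : {n : ℕ} → Graph n → Fin n → List (Fin n)
neighbours G v = filterᵇ (adj G v) (allFin _)

deg : {n : ℕ} → Graph n → Fin n → ℕ
deg G v = length (neighbours G v)

MaxDegreeAtMost : {n : ℕ} → ℕ → Graph n → Set
MaxDegreeAtMost d G = ∀ v → deg G v ≤ d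

-- variable type: pairs of vertices; the edge {u,v} is represented by the
-- ordered pair (min, max)
EdgeVar : ℕ → Set
EdgeVar n = Fin n × Fin n

edgeVar : {n : ℕ} → Fin n → Fin n → EdgeVar n
edgeVar u v = if toℕ u <ᵇ toℕ v then (u , v) else (v , u)

allBools : ℕ → List (List Bool)
allBools zero    = [] ∷ []
allBools (suc m) = map (true ∷_) (allBools m) ++ map (false ∷_) (allBools m)

parity : List Bool → Bool
parity = foldr _xor_ false

-- the clause over the variables x_{v u} (u ∈ us) excluding exactly the
-- assignment giving x_{v u} the value b (paired entrywise)
excludingClause : {n : ℕ} → Fin n → List (Fin n) → List Bool → Clause (EdgeVar n)
excludingClause v []       _        = []
excludingClause v (u ∷ us) []       = []
excludingClause v (u ∷ us) (b ∷ bs) = (edgeVar v u , not b) ∷ excludingClause v us bs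

-- clauses for the constraint ⊕_{e ∋ v} x_e = c_v : one per violating assignment
vertexClauses : {n : ℕ} → Graph n → (Fin n → Bool) → Fin n → CNF (EdgeVar n)
vertexClauses G c v =
  map (excludingClause v (neighbours G v))
      (filterᵇ (λ bs → parity bs xor c v) (allBools (deg G v)))

Tseitin : {n : ℕ} → Graph n → (Fin n → Bool) → CNF (EdgeVar n)
Tseitin G c = concatMap (vertexClauses G c) (allFin _)

totalCharge : {n : ℕ} → (Fin n → Bool) → Bool
totalCharge c = foldr (λ v b → c v xor b) false (allFin _)

{-# OPTIONS --safe #-}
-- When the total charge is odd, T_{G,c} is itself an odd hitting
-- formula, hence refutes itself, and it has at most 2^d · |V| clauses. Indeed an
-- assignment falsifies exactly one of the clauses of vertex v if the constraint
-- of v is violated and none otherwise, and the number of violated constraints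
-- has the parity of ⊕_v (⊕_{e ∋ v} x_e ⊕ c_v) = ⊕_v c_v = 1, because every edge
-- is counted at both of its ends (handshake lemma).
module Submission where

open import Defs hiding (sym)
open import Data.Nat using (ℕ; zero; suc; _+_; _*_; _^_; _≤_; z≤n; _%_; _<ᵇ_)
open import Data.Nat.Properties
  using (+-identityʳ; +-comm; +-mono-≤; ^-monoʳ-≤; *-comm; *-identityʳ; ≤-trans; ≤-reflexive)
open import Data.Bool using (Bool; true; false; not; _∧_; _xor_; if_then_else_; T?)
open import Data.Bool.Properties
  using (xor-∧-commutativeRing; not-distribˡ-xor; xor-same; xor-identityʳ; ∧-zeroʳ)
open import Data.Fin using (Fin; toℕ)
open import Data.Fin.Properties using (toℕ-injective)
open import Data.List using (List; []; _∷_; length; map; foldr; filterᵇ; _++_; concatMap; allFin)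
open import Data.List.Properties using (length-++; length-map; length-tabulate; filter-++; length-filter)
open import Data.List.Relation.Binary.Subset.Propositional.Properties using (⊆-refl)
open import Data.Product using (∃; ∃₂; _×_; _,_)
open import Relation.Nullary using (contradiction)
open import Function using (_∘_)
open import Relation.Binary.PropositionalEquality
  using (_≡_; refl; sym; trans; cong; cong₂; subst; module ≡-Reasoning)
open import Algebra.Bundles using (CommutativeRing; CommutativeMonoid)
open import Algebra.Properties.CommutativeSemigroup
  (CommutativeMonoid.commutativeSemigroup (CommutativeRing.+-commutativeMonoid xor-∧-commutativeRing))
  using (interchange)

open ≡-Reasoning

private
  variable
    A B : Set

odd : ℕ → Bool
odd zero    = false
odd (suc n) = not (odd n)

odd-+ : ∀ m n → odd (m + n) ≡ odd m xor odd n
odd-+ zero    n = refl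
odd-+ (suc m) n = trans (cong not (odd-+ m n)) (not-distribˡ-xor (odd m) (odd n))

odd-if : ∀ b → odd (if b then 1 else 0) ≡ b
odd-if true  = refl
odd-if false = refl

odd⇒%2≡1 : ∀ n → odd n ≡ true → n % 2 ≡ 1
odd⇒%2≡1 (suc zero)    _ = refl
odd⇒%2≡1 (suc (suc n)) oddn with odd n in eq
... | true = odd⇒%2≡1 n eq

count : (A → Bool) → List A → ℕ
count p xs = length (filterᵇ p xs)

count-++ : ∀ (p : A → Bool) xs ys → count p (xs ++ ys) ≡ count p xs + count p ys
count-++ p xs ys = trans (cong length (filter-++ (T? ∘ p) xs ys)) (length-++ (filterᵇ p xs))

count-map : ∀ (p : B → Bool) (f : A → B) xs → count p (map f xs) ≡ count (p ∘ f) xs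
count-map p f []       = refl
count-map p f (x ∷ xs) with p (f x)
... | true  = cong suc (count-map p f xs)
... | false = count-map p f xs

count-filterᵇ : ∀ (p q : A → Bool) xs → count p (filterᵇ q xs) ≡ count (λ x → q x ∧ p x) xs
count-filterᵇ p q []       = refl
count-filterᵇ p q (x ∷ xs) with q x
... | false = count-filterᵇ p q xs
... | true with p x
...   | true  = cong suc (count-filterᵇ p q xs)
...   | false = count-filterᵇ p q xs

count-cong : ∀ {p q : A → Bool} → (∀ x → p x ≡ q x) → ∀ xs → count p xs ≡ count q xs
count-cong p≗q []       = refl
count-cong {q = q} p≗q (x ∷ xs) rewrite p≗q x with q x
... | true  = cong suc (count-cong p≗q xs)
... | false = count-cong p≗q xs

count-none : ∀ {p : A → Bool} → (∀ x → p x ≡ false) → ∀ xs → count p xs ≡ 0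
count-none p≗false []       = refl
count-none p≗false (x ∷ xs) rewrite p≗false x = count-none p≗false xs

length-filterᵇ≤ : ∀ (p : A → Bool) xs → length (filterᵇ p xs) ≤ length xs
length-filterᵇ≤ p = length-filter (T? ∘ p)

length-concatMap≤ : ∀ (f : A → List B) {K} → (∀ x → length (f x) ≤ K) →
  ∀ xs → length (concatMap f xs) ≤ length xs * K
length-concatMap≤ f bound []       = z≤n
length-concatMap≤ f bound (x ∷ xs) =
  subst (_≤ _) (sym (length-++ (f x))) (+-mono-≤ (bound x) (length-concatMap≤ f bound xs))

xorSum : (A → Bool) → List A → Bool
xorSum f = foldr (λ x b → f x xor b) false

xorSum-cong : ∀ {f g : A → Bool} → (∀ x → f x ≡ g x) → ∀ xs → xorSum f xs ≡ xorSum g xs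
xorSum-cong f≗g []       = refl
xorSum-cong f≗g (x ∷ xs) = cong₂ _xor_ (f≗g x) (xorSum-cong f≗g xs)

xorSum-xor : ∀ (f g : A → Bool) xs → xorSum (λ x → f x xor g x) xs ≡ xorSum f xs xor xorSum g xs
xorSum-xor f g []       = refl
xorSum-xor f g (x ∷ xs) =
  trans (cong ((f x xor g x) xor_) (xorSum-xor f g xs)) (interchange (f x) (g x) (xorSum f xs) (xorSum g xs))

odd-count-concatMap : ∀ (p : A → Bool) (f : B → List A) xs →
  odd (count p (concatMap f xs)) ≡ xorSum (odd ∘ count p ∘ f) xs
odd-count-concatMap p f []       = refl
odd-count-concatMap p f (x ∷ xs) = begin
  odd (count p (f x ++ concatMap f xs))             ≡⟨ cong odd (count-++ p (f x) (concatMap f xs)) ⟩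
  odd (count p (f x) + count p (concatMap f xs))    ≡⟨ odd-+ (count p (f x)) _ ⟩
  odd (count p (f x)) xor odd (count p (concatMap f xs))
    ≡⟨ cong (odd (count p (f x)) xor_) (odd-count-concatMap p f xs) ⟩
  xorSum (odd ∘ count p ∘ f) (x ∷ xs)               ∎

-- Double counting: each off-diagonal term f x y occurs twice, as f x y and as f y x.
xorSum²-symmetric : ∀ (f : A → A → Bool) → (∀ x y → f x y ≡ f y x) → (∀ x → f x x ≡ false) →
  ∀ xs → xorSum (λ x → xorSum (f x) xs) xs ≡ false
xorSum²-symmetric f f-sym f-diag []       = refl
xorSum²-symmetric f f-sym f-diag (x ∷ xs) = begin
  (f x x xor S) xor xorSum (λ y → f y x xor xorSum (f y) xs) xs
    ≡⟨ cong₂ _xor_ (cong (_xor S) (f-diag x)) (xorSum-xor (λ y → f y x) (λ y → xorSum (f y) xs) xs) ⟩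
  S xor (xorSum (λ y → f y x) xs xor xorSum (λ y → xorSum (f y) xs) xs)
    ≡⟨ cong (S xor_) (cong₂ _xor_ (xorSum-cong (λ y → f-sym y x) xs) (xorSum²-symmetric f f-sym f-diag xs)) ⟩
  S xor (S xor false)  ≡⟨ cong (S xor_) (xor-identityʳ S) ⟩
  S xor S              ≡⟨ xor-same S ⟩
  false                ∎
  where S = xorSum (f x) xs

parity-map-filterᵇ : ∀ (p g : A → Bool) xs → parity (map g (filterᵇ p xs)) ≡ xorSum (λ x → p x ∧ g x) xs
parity-map-filterᵇ p g []       = refl
parity-map-filterᵇ p g (x ∷ xs) with p x
... | true  = cong (g x xor_) (parity-map-filterᵇ p g xs)
... | false = parity-map-filterᵇ p g xs

handshake : ∀ {n} (G : Graph n) (w : Fin n → Fin n → Bool) → (∀ u v → w u v ≡ w v u) →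
  xorSum (λ v → parity (map (w v) (neighbours G v))) (allFin n) ≡ false
handshake {n} G w w-sym = begin
  xorSum (λ v → parity (map (w v) (neighbours G v))) (allFin n)
    ≡⟨ xorSum-cong (λ v → parity-map-filterᵇ (adj G v) (w v) (allFin n)) (allFin n) ⟩
  xorSum (λ v → xorSum (weight v) (allFin n)) (allFin n)
    ≡⟨ xorSum²-symmetric weight weight-sym weight-diag (allFin n) ⟩
  false ∎
  where
  weight : Fin n → Fin n → Bool
  weight u v = adj G u v ∧ w u v
  weight-sym : ∀ u v → weight u v ≡ weight v u
  weight-sym u v = cong₂ _∧_ (Graph.sym G u v) (w-sym u v)
  weight-diag : ∀ v → weight v v ≡ false
  weight-diag v = cong (_∧ w v v) (irrefl G v)

<ᵇ-asym : ∀ m n → (m <ᵇ n) ≡ true → (n <ᵇ m) ≡ false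
<ᵇ-asym zero    (suc n) _   = refl
<ᵇ-asym (suc m) (suc n) m<n = <ᵇ-asym m n m<n

≮ᵇ-antisym : ∀ m n → (m <ᵇ n) ≡ false → (n <ᵇ m) ≡ false → m ≡ n
≮ᵇ-antisym zero    zero    _   _   = refl
≮ᵇ-antisym (suc m) (suc n) m≮n n≮m = cong suc (≮ᵇ-antisym m n m≮n n≮m)

edgeVar-comm : ∀ {n} (u v : Fin n) → edgeVar u v ≡ edgeVar v u
edgeVar-comm u v with toℕ u <ᵇ toℕ v in u<v | toℕ v <ᵇ toℕ u in v<u
... | true  | true  = contradiction (trans (sym v<u) (<ᵇ-asym (toℕ u) (toℕ v) u<v)) λ ()
... | true  | false = refl
... | false | true  = refl
... | false | false = cong₂ _,_ (sym u≡v) u≡v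
  where u≡v = toℕ-injective (≮ᵇ-antisym (toℕ u) (toℕ v) u<v v<u)

length-allBools : ∀ m → length (allBools m) ≡ 2 ^ m
length-allBools zero    = refl
length-allBools (suc m) = begin
  length (map (true ∷_) (allBools m) ++ map (false ∷_) (allBools m))
    ≡⟨ length-++ (map (true ∷_) (allBools m)) ⟩
  length (map (true ∷_) (allBools m)) + length (map (false ∷_) (allBools m))
    ≡⟨ cong₂ _+_ (length-map _ (allBools m)) (length-map _ (allBools m)) ⟩
  length (allBools m) + length (allBools m)
    ≡⟨ cong₂ _+_ (length-allBools m) (trans (length-allBools m) (sym (+-identityʳ (2 ^ m)))) ⟩
  2 ^ suc m ∎

count-allBools-suc : ∀ (p : List Bool → Bool) b m →
  count p (allBools (suc m)) ≡ count (p ∘ (b ∷_)) (allBools m) + count (p ∘ (not b ∷_)) (allBools m)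
count-allBools-suc p b m = trans (count-++ p (map (true ∷_) bss) (map (false ∷_) bss)) (split b)
  where
  bss = allBools m
  split : ∀ b → count p (map (true ∷_) bss) + count p (map (false ∷_) bss)
              ≡ count (p ∘ (b ∷_)) bss + count (p ∘ (not b ∷_)) bss
  split true  = cong₂ _+_ (count-map p (true ∷_) bss) (count-map p (false ∷_) bss)
  split false = trans (split true) (+-comm (count (p ∘ (true ∷_)) bss) _)

module _ {n : ℕ} (α : Assignment (EdgeVar n)) (v : Fin n) where

  edgeValues : List (Fin n) → List Bool
  edgeValues = map (λ u → α (edgeVar v u))

  falsifies-excludingClause-match : ∀ u us bs →
    falsifiesᵇ α (excludingClause v (u ∷ us) (α (edgeVar v u) ∷ bs)) ≡ falsifiesᵇ α (excludingClause v us bs)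
  falsifies-excludingClause-match u us bs with α (edgeVar v u) in αe
  ... | true  rewrite αe = refl
  ... | false rewrite αe = refl

  falsifies-excludingClause-mismatch : ∀ u us bs →
    falsifiesᵇ α (excludingClause v (u ∷ us) (not (α (edgeVar v u)) ∷ bs)) ≡ false
  falsifies-excludingClause-mismatch u us bs with α (edgeVar v u) in αe
  ... | true  rewrite αe = refl
  ... | false rewrite αe = refl

  -- The clause excluding bs is falsified exactly when bs is the pattern of values α gives to the edges.
  count-falsified-excludingClauses : ∀ (q : List Bool → Bool) us →
    count (λ bs → q bs ∧ falsifiesᵇ α (excludingClause v us bs)) (allBools (length us))
      ≡ (if q (edgeValues us) then 1 else 0)
  count-falsified-excludingClauses q [] with q []
  ... | true  = refl
  ... | false = refl
  count-falsified-excludingClauses q (u ∷ us) = begin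
    count P (allBools (suc (length us)))
      ≡⟨ count-allBools-suc P a (length us) ⟩
    count (P ∘ (a ∷_)) bss + count (P ∘ (not a ∷_)) bss
      ≡⟨ cong₂ _+_ (count-cong (λ bs → cong (q (a ∷ bs) ∧_) (falsifies-excludingClause-match u us bs)) bss)
                   (count-none (λ bs → trans (cong (q (not a ∷ bs) ∧_) (falsifies-excludingClause-mismatch u us bs))
                                             (∧-zeroʳ _)) bss) ⟩
    count (λ bs → q (a ∷ bs) ∧ falsifiesᵇ α (excludingClause v us bs)) bss + 0
      ≡⟨ +-identityʳ _ ⟩
    count (λ bs → q (a ∷ bs) ∧ falsifiesᵇ α (excludingClause v us bs)) bss
      ≡⟨ count-falsified-excludingClauses (q ∘ (a ∷_)) us ⟩
    (if q (edgeValues (u ∷ us)) then 1 else 0) ∎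
    where
    a = α (edgeVar v u)
    bss = allBools (length us)
    P = λ bs → q bs ∧ falsifiesᵇ α (excludingClause v (u ∷ us) bs)

violated : ∀ {n} → Graph n → (Fin n → Bool) → Assignment (EdgeVar n) → Fin n → Bool
violated G c α v = parity (edgeValues α v (neighbours G v)) xor c v

numFalsified-vertexClauses : ∀ {n} (G : Graph n) c α v →
  numFalsified α (vertexClauses G c v) ≡ (if violated G c α v then 1 else 0)
numFalsified-vertexClauses G c α v = begin
  count (falsifiesᵇ α) (map (excludingClause v us) (filterᵇ violates (allBools (deg G v))))
    ≡⟨ count-map (falsifiesᵇ α) (excludingClause v us) (filterᵇ violates (allBools (deg G v))) ⟩
  count (falsifiesᵇ α ∘ excludingClause v us) (filterᵇ violates (allBools (deg G v)))
    ≡⟨ count-filterᵇ (falsifiesᵇ α ∘ excludingClause v us) violates (allBools (deg G v)) ⟩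
  count (λ bs → violates bs ∧ falsifiesᵇ α (excludingClause v us bs)) (allBools (length us))
    ≡⟨ count-falsified-excludingClauses α v violates us ⟩
  (if violated G c α v then 1 else 0) ∎
  where
  us = neighbours G v
  violates = λ bs → parity bs xor c v

odd-numFalsified-Tseitin : ∀ {n} (G : Graph n) c α → odd (numFalsified α (Tseitin G c)) ≡ totalCharge c
odd-numFalsified-Tseitin {n} G c α = begin
  odd (count (falsifiesᵇ α) (concatMap (vertexClauses G c) (allFin n)))
    ≡⟨ odd-count-concatMap (falsifiesᵇ α) (vertexClauses G c) (allFin n) ⟩
  xorSum (λ v → odd (numFalsified α (vertexClauses G c v))) (allFin n)
    ≡⟨ xorSum-cong {g = violated G c α}
         (λ v → trans (cong odd (numFalsified-vertexClauses G c α v)) (odd-if _)) (allFin n) ⟩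
  xorSum (violated G c α) (allFin n)
    ≡⟨ xorSum-xor (λ v → parity (edgeValues α v (neighbours G v))) c (allFin n) ⟩
  xorSum (λ v → parity (edgeValues α v (neighbours G v))) (allFin n) xor totalCharge c
    ≡⟨ cong (_xor totalCharge c) (handshake G (λ u v → α (edgeVar u v)) (λ u v → cong α (edgeVar-comm u v))) ⟩
  totalCharge c ∎

falsifiesCNFᵇ≡false⇒numFalsified≡0 : ∀ {X} (α : Assignment X) H →
  falsifiesCNFᵇ α H ≡ false → numFalsified α H ≡ 0
falsifiesCNFᵇ≡false⇒numFalsified≡0 α []      _ = refl
falsifiesCNFᵇ≡false⇒numFalsified≡0 α (C ∷ H) e with falsifiesᵇ α C
... | false = falsifiesCNFᵇ≡false⇒numFalsified≡0 α H e

oddlyFalsified⇒unsatisfiable : ∀ {X} (H : CNF X) →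
  (∀ α → odd (numFalsified α H) ≡ true) → Unsatisfiable H
oddlyFalsified⇒unsatisfiable H odd-falsified α with falsifiesCNFᵇ α H in e
... | true  = refl
... | false = contradiction (trans (sym (cong odd (falsifiesCNFᵇ≡false⇒numFalsified≡0 α H e))) (odd-falsified α)) λ ()

oddlyFalsified⇒oddHitting : ∀ {X} (H : CNF X) →
  (∀ α → odd (numFalsified α H) ≡ true) → OddHitting H
oddlyFalsified⇒oddHitting H odd-falsified α _ = odd⇒%2≡1 (numFalsified α H) (odd-falsified α)

Tseitin-refutes-itself : ∀ {n} (G : Graph n) c → totalCharge c ≡ true → IsOHRefutation (Tseitin G c) (Tseitin G c)
Tseitin-refutes-itself G c odd-charge =
  oddlyFalsified⇒unsatisfiable (Tseitin G c) odd-falsified ,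
  oddlyFalsified⇒oddHitting (Tseitin G c) odd-falsified ,
  λ C∈T → _ , C∈T , ⊆-refl
  where
  odd-falsified = λ α → trans (odd-numFalsified-Tseitin G c α) odd-charge

length-Tseitin≤ : ∀ {n} d (G : Graph n) c → MaxDegreeAtMost d G → length (Tseitin G c) ≤ n * 2 ^ d
length-Tseitin≤ {n} d G c maxdeg =
  subst (λ m → length (Tseitin G c) ≤ m * 2 ^ d) (length-tabulate {n = n} (λ v → v))
        (length-concatMap≤ (vertexClauses G c) length-vertexClauses≤ (allFin n))
  where
  length-vertexClauses≤ : ∀ v → length (vertexClauses G c v) ≤ 2 ^ d
  length-vertexClauses≤ v =
    ≤-trans (≤-reflexive (length-map (excludingClause v (neighbours G v)) (filterᵇ violates bss)))
      (≤-trans (length-filterᵇ≤ violates bss)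
        (subst (_≤ 2 ^ d) (sym (length-allBools (deg G v))) (^-monoʳ-≤ 2 (maxdeg v))))
    where
    bss = allBools (deg G v)
    violates = λ bs → parity bs xor c v

proposition5p1 : (d : ℕ) → ∃₂ λ (C k : ℕ) →
    (n : ℕ) (G : Graph n) → MaxDegreeAtMost d G →
    (c : Fin n → Bool) → totalCharge c ≡ true →
    ∃ λ H → IsOHRefutation (Tseitin G c) H × length H ≤ C * n ^ k
proposition5p1 d = 2 ^ d , 1 , λ n G maxdeg c odd-charge →
  Tseitin G c , Tseitin-refutes-itself G c odd-charge ,
  ≤-trans (length-Tseitin≤ d G c maxdeg)
          (≤-reflexive (trans (*-comm n (2 ^ d)) (cong (2 ^ d *_) (sym (*-identityʳ n)))))
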